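{- Let $\alpha(k)$ be the largest odd divisor of $k$, $V(n)=\sum_{k=1}^n\frac{\alpha(k)}{k}$ and $v(n)=V(n)-\frac{2n}{3}$. Then for every positive integer $n$, $\frac13<v(2n+1)<\frac23$ and $0<v(2n)<\frac13$.
   Context: $\alpha(k)$ is the largest odd divisor of the positive integer $k$. -}

module Defs where

open import Data.Nat using (ℕ; zero; suc; _+_; _*_; _%_; _≟_)
open import Data.Nat.Divisibility using (_∣?_)
open import Data.Bool using (Bool; true; false; _∧_)
open import Relation.Nullary.Decidable using (⌊_⌋)
open import Data.Rational using (ℚ; 0ℚ)
import Data.Rational as ℚ
open import Data.Integer using (+_)

isOddDivisor : ℕ → ℕ → Bool
isOddDivisor k d = ⌊ d % 2 ≟ 1 ⌋ ∧ ⌊ d ∣? k ⌋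

-- largestOddDivisorBelow k d = the largest d' ≤ d that is an odd divisor of k
-- (searching downward from d; returns 1 by default when d reaches 0 — never
-- reached for k ≥ 1, since 1 is an odd divisor of every k)
largestOddDivisorBelow : ℕ → ℕ → ℕ
largestOddDivisorBelow k zero = 1
largestOddDivisorBelow k (suc d) with isOddDivisor k (suc d)
... | true  = suc d
... | false = largestOddDivisorBelow k d

-- α k = the largest odd divisor of the positive integer k
-- (every divisor of k ≥ 1 is ≤ k, so searching from k downward is exhaustive)
α : ℕ → ℕ
α k = largestOddDivisorBelow k k

V : ℕ → ℚ
V zero    = 0ℚ
V (suc n) = V n ℚ.+ ((+ α (suc n)) ℚ./ (suc n))

v : ℕ → ℚ
v n = V n ℚ.- ((+ (2 * n)) ℚ./ 3)

{-# OPTIONS --safe #-}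
module Submission where

-- Since α fixes odd numbers and α (2 k) = α k, the odd terms of V (2 m) contribute 1 each and the
-- even ones contribute half of V m, so V (2 m) = m + V m / 2.  Hence v (2 m) = v m / 2 and
-- v (2 m + 1) = v m / 2 + 1/3.  Both maps send the interval (0, 2/3), which contains v 1 = 1/3,
-- into (0, 1/3) and (1/3, 2/3) respectively, so by strong induction v n ∈ (0, 2/3) for all n ≥ 1,
-- and one more halving step gives the two bounds.

open import Defs
open import Data.Bool using (T; true; false)
open import Data.Bool.Properties using (T-∧)
open import Data.Nat using (ℕ; zero; suc; NonZero; _+_; _*_; _%_; _/_; _≤_; _<_; z≤n; z<s; s<s; _≟_)
open import Data.Nat.Properties
  using (≤-antisym; ≤-pred; m≤n⇒m<n∨m≡n; *-comm; *-suc; *-identityˡ; +-suc; +-comm; m<m+n; m<n⇒m<1+n)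
open import Data.Nat.Divisibility using (_∣_; _∣?_; 1∣_; ∣-refl; ∣⇒≤; ∣n⇒∣m*n)
open import Data.Nat.DivMod using (m≡m%n+[m/n]*n; [m+kn]%n≡m%n)
open import Data.Nat.Coprimality using (Coprime; coprime-+; 1-coprimeTo; coprime-divisor)
open import Data.Nat.Induction using (<-rec)
open import Data.Integer as ℤ using (ℤ; +_; +<+)
import Data.Integer.Properties as ℤ
open import Data.Integer.Tactic.RingSolver using (solve-∀)
open import Data.Rational as ℚ using (ℚ; 0ℚ; 1ℚ; ½; Positive; toℚᵘ; *<*)
open import Data.Rational.Properties
  using (toℚᵘ-injective; toℚᵘ-fromℚᵘ; toℚᵘ-homo-+; toℚᵘ-homo-*; *-monoʳ-<-pos; +-monoˡ-<;
         <-≤-trans; ≤-<-trans; <⇒≤; ≤-refl)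
open import Data.Rational.Unnormalised as ℚᵘ using (mkℚᵘ; *≡*)
import Data.Rational.Unnormalised.Properties as ℚᵘ
open import Data.Rational.Solver using (module +-*-Solver)
open import Data.Product using (_×_; _,_; proj₁; proj₂)
open import Data.Sum using (inj₁; inj₂)
open import Data.Unit using (tt)
open import Function.Base using (case_of_)
open import Function.Bundles using (Equivalence)
open import Relation.Nullary.Decidable using (⌊_⌋; toWitness; fromWitness)
open import Relation.Binary.PropositionalEquality

isOddDivisor⇒ : ∀ {k d} → T (isOddDivisor k d) → d % 2 ≡ 1 × d ∣ k
isOddDivisor⇒ {k} {d} t with Equivalence.to (T-∧ {⌊ d % 2 ≟ 1 ⌋} {⌊ d ∣? k ⌋}) t
... | odd , d∣k = toWitness odd , toWitness d∣k

⇒isOddDivisor : ∀ {k d} → d % 2 ≡ 1 → d ∣ k → T (isOddDivisor k d)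
⇒isOddDivisor {k} {d} odd d∣k =
  Equivalence.from (T-∧ {⌊ d % 2 ≟ 1 ⌋} {⌊ d ∣? k ⌋}) (fromWitness odd , fromWitness d∣k)

largestOddDivisorBelow-isOddDivisor : ∀ k d → T (isOddDivisor k (largestOddDivisorBelow k d))
largestOddDivisorBelow-isOddDivisor k zero = ⇒isOddDivisor refl (1∣ k)
largestOddDivisorBelow-isOddDivisor k (suc d) with isOddDivisor k (suc d) in eq
... | true  = subst T (sym eq) tt
... | false = largestOddDivisorBelow-isOddDivisor k d

largestOddDivisorBelow-maximal : ∀ k d e → e ≤ d → T (isOddDivisor k e) →
                                 e ≤ largestOddDivisorBelow k d
largestOddDivisorBelow-maximal k zero .zero z≤n _ = z≤n
largestOddDivisorBelow-maximal k (suc d) e e≤1+d t with isOddDivisor k (suc d) in eq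
... | true  = e≤1+d
... | false with m≤n⇒m<n∨m≡n e≤1+d
...   | inj₁ e<1+d = largestOddDivisorBelow-maximal k d e (≤-pred e<1+d) t
...   | inj₂ refl  = case subst T eq t of λ ()

α-isOddDivisor : ∀ k → α k % 2 ≡ 1 × α k ∣ k
α-isOddDivisor k = isOddDivisor⇒ {k} {α k} (largestOddDivisorBelow-isOddDivisor k k)

α-odd : ∀ k → α k % 2 ≡ 1
α-odd k = proj₁ (α-isOddDivisor k)

α-∣ : ∀ k → α k ∣ k
α-∣ k = proj₂ (α-isOddDivisor k)

α-maximal : ∀ {k d} .{{_ : NonZero k}} → d % 2 ≡ 1 → d ∣ k → d ≤ α k
α-maximal {k} odd d∣k = largestOddDivisorBelow-maximal k k _ (∣⇒≤ d∣k) (⇒isOddDivisor odd d∣k)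

odd⇒coprime[2] : ∀ {d} → d % 2 ≡ 1 → Coprime d 2
odd⇒coprime[2] {d} odd = subst (λ x → Coprime x 2) (sym d≡1+[d/2]*2) (coprime[1+t*2,2] (d / 2))
  where
  d≡1+[d/2]*2 : d ≡ 1 + d / 2 * 2
  d≡1+[d/2]*2 = trans (m≡m%n+[m/n]*n d 2) (cong (_+ d / 2 * 2) odd)
  coprime[1+t*2,2] : ∀ t → Coprime (1 + t * 2) 2
  coprime[1+t*2,2] zero    = 1-coprimeTo 2
  coprime[1+t*2,2] (suc t) = coprime-+ (coprime[1+t*2,2] t)

1+2m%2≡1 : ∀ m → (1 + 2 * m) % 2 ≡ 1
1+2m%2≡1 m = trans (cong (λ x → suc x % 2) (*-comm 2 m)) ([m+kn]%n≡m%n 1 m 2)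

α-fixes-odd : ∀ {k} → k % 2 ≡ 1 → α k ≡ k
α-fixes-odd {suc k} odd = ≤-antisym (∣⇒≤ (α-∣ (suc k))) (α-maximal odd ∣-refl)

α-double : ∀ k → α (2 * k) ≡ α k
α-double zero      = refl
α-double k@(suc _) = ≤-antisym
  (α-maximal (α-odd (2 * k)) (coprime-divisor (odd⇒coprime[2] (α-odd (2 * k))) (α-∣ (2 * k))))
  (α-maximal (α-odd k) (∣n⇒∣m*n 2 (α-∣ k)))

toℚᵘ-/ : ∀ i d → toℚᵘ (i ℚ./ suc d) ℚᵘ.≃ mkℚᵘ i d
toℚᵘ-/ i d = toℚᵘ-fromℚᵘ (mkℚᵘ i d)

/-distribʳ-+ : ∀ a b d → + (a + b) ℚ./ suc d ≡ + a ℚ./ suc d ℚ.+ + b ℚ./ suc d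
/-distribʳ-+ a b d = toℚᵘ-injective (begin
  toℚᵘ (+ (a + b) ℚ./ suc d)
    ≈⟨ toℚᵘ-/ (+ (a + b)) d ⟩
  mkℚᵘ (+ (a + b)) d
    ≈⟨ *≡* (trans (cong (ℤ._* (s ℤ.* s)) (ℤ.pos-+ a b)) (cross (+ a) (+ b) s)) ⟩
  mkℚᵘ (+ a) d ℚᵘ.+ mkℚᵘ (+ b) d
    ≈⟨ ℚᵘ.+-cong (toℚᵘ-/ (+ a) d) (toℚᵘ-/ (+ b) d) ⟨
  toℚᵘ (+ a ℚ./ suc d) ℚᵘ.+ toℚᵘ (+ b ℚ./ suc d)
    ≈⟨ toℚᵘ-homo-+ (+ a ℚ./ suc d) (+ b ℚ./ suc d) ⟨
  toℚᵘ (+ a ℚ./ suc d ℚ.+ + b ℚ./ suc d) ∎)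
  where
  open ℚᵘ.≃-Reasoning
  s : ℤ
  s = + suc d
  cross : ∀ (i j s : ℤ) → (i ℤ.+ j) ℤ.* (s ℤ.* s) ≡ (i ℤ.* s ℤ.+ j ℤ.* s) ℤ.* s
  cross = solve-∀

/-distrib-* : ∀ a b d e → + (a * b) ℚ./ (suc d * suc e) ≡ (+ a ℚ./ suc d) ℚ.* (+ b ℚ./ suc e)
/-distrib-* a b d e = toℚᵘ-injective (begin
  toℚᵘ (+ (a * b) ℚ./ (suc d * suc e))
    ≈⟨ toℚᵘ-/ (+ (a * b)) _ ⟩
  mkℚᵘ (+ (a * b)) (e + d * suc e)
    ≈⟨ *≡* (cong (ℤ._* (+ suc d ℤ.* + suc e)) (ℤ.pos-* a b)) ⟩
  mkℚᵘ (+ a) d ℚᵘ.* mkℚᵘ (+ b) e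
    ≈⟨ ℚᵘ.*-cong (toℚᵘ-/ (+ a) d) (toℚᵘ-/ (+ b) e) ⟨
  toℚᵘ (+ a ℚ./ suc d) ℚᵘ.* toℚᵘ (+ b ℚ./ suc e)
    ≈⟨ toℚᵘ-homo-* (+ a ℚ./ suc d) (+ b ℚ./ suc e) ⟨
  toℚᵘ ((+ a ℚ./ suc d) ℚ.* (+ b ℚ./ suc e)) ∎)
  where open ℚᵘ.≃-Reasoning

n/n≡1 : ∀ n → + suc n ℚ./ suc n ≡ 1ℚ
n/n≡1 n = toℚᵘ-injective (ℚᵘ.≃-trans (toℚᵘ-/ (+ suc n) n) (*≡* (ℤ.*-comm (+ suc n) (+ 1))))

⅓ ⅔ : ℚ
⅓ = + 1 ℚ./ 3
⅔ = + 2 ℚ./ 3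

module _ where
  open ≡-Reasoning
  open +-*-Solver

  α-ratio-odd : ∀ m → + α (1 + 2 * m) ℚ./ (1 + 2 * m) ≡ 1ℚ
  α-ratio-odd m = begin
    + α (1 + 2 * m) ℚ./ (1 + 2 * m)
      ≡⟨ cong (λ a → + a ℚ./ (1 + 2 * m)) (α-fixes-odd {1 + 2 * m} (1+2m%2≡1 m)) ⟩
    + (1 + 2 * m) ℚ./ (1 + 2 * m)
      ≡⟨ n/n≡1 (2 * m) ⟩
    1ℚ ∎

  α-ratio-double : ∀ m → + α (2 * suc m) ℚ./ (2 * suc m) ≡ ½ ℚ.* (+ α (suc m) ℚ./ suc m)
  α-ratio-double m = begin
    + α (2 * suc m) ℚ./ (2 * suc m)
      ≡⟨ cong (λ a → + a ℚ./ (2 * suc m)) (trans (α-double (suc m)) (sym (*-identityˡ _))) ⟩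
    + (1 * α (suc m)) ℚ./ (2 * suc m)
      ≡⟨ /-distrib-* 1 (α (suc m)) 1 m ⟩
    ½ ℚ.* (+ α (suc m) ℚ./ suc m) ∎

  V-double : ∀ m → V (2 * m) ≡ + m ℚ./ 1 ℚ.+ ½ ℚ.* V m
  V-double zero    = refl
  -- 2 * suc m unfolds to suc (m + suc (m + 0)), so V (2 * suc m) reduces by one step.
  V-double (suc m) = begin
    V (2 * suc m)
      ≡⟨ cong (λ n → V n ℚ.+ r₂) (+-suc m (m + 0)) ⟩
    V (2 * m) ℚ.+ r₁ ℚ.+ r₂
      ≡⟨ cong₂ (λ y z → y ℚ.+ z ℚ.+ r₂) (V-double m) (α-ratio-odd m) ⟩
    x ℚ.+ ½ ℚ.* V m ℚ.+ 1ℚ ℚ.+ r₂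
      ≡⟨ cong (x ℚ.+ ½ ℚ.* V m ℚ.+ 1ℚ ℚ.+_) (α-ratio-double m) ⟩
    x ℚ.+ ½ ℚ.* V m ℚ.+ 1ℚ ℚ.+ ½ ℚ.* r
      ≡⟨ regroup x (V m) r ⟩
    (1ℚ ℚ.+ x) ℚ.+ ½ ℚ.* (V m ℚ.+ r)
      ≡⟨ cong (ℚ._+ ½ ℚ.* V (suc m)) (/-distribʳ-+ 1 m 0) ⟨
    + suc m ℚ./ 1 ℚ.+ ½ ℚ.* V (suc m) ∎
    where
    x r₁ r₂ r : ℚ
    x  = + m ℚ./ 1
    r₁ = + α (1 + 2 * m) ℚ./ (1 + 2 * m)
    r₂ = + α (2 * suc m) ℚ./ (2 * suc m)
    r  = + α (suc m) ℚ./ suc m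
    regroup : ∀ x y z → x ℚ.+ ½ ℚ.* y ℚ.+ 1ℚ ℚ.+ ½ ℚ.* z ≡ (1ℚ ℚ.+ x) ℚ.+ ½ ℚ.* (y ℚ.+ z)
    regroup = solve 3 (λ x y z → x :+ con ½ :* y :+ con 1ℚ :+ con ½ :* z
                                 := (con 1ℚ :+ x) :+ con ½ :* (y :+ z)) refl

  v≡V-⅔n : ∀ n → v n ≡ V n ℚ.- ⅔ ℚ.* (+ n ℚ./ 1)
  v≡V-⅔n n = cong (λ y → V n ℚ.- y) (/-distrib-* 2 n 2 0)

  v-double : ∀ m → v (2 * m) ≡ ½ ℚ.* v m
  v-double m = begin
    v (2 * m)
      ≡⟨ v≡V-⅔n (2 * m) ⟩
    V (2 * m) ℚ.- ⅔ ℚ.* (+ (2 * m) ℚ./ 1)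
      ≡⟨ cong₂ (λ y z → y ℚ.- ⅔ ℚ.* z) (V-double m) (/-distrib-* 2 m 0 0) ⟩
    x ℚ.+ ½ ℚ.* V m ℚ.- ⅔ ℚ.* ((+ 2 ℚ./ 1) ℚ.* x)
      ≡⟨ regroup x (V m) ⟩
    ½ ℚ.* (V m ℚ.- ⅔ ℚ.* x)
      ≡⟨ cong (½ ℚ.*_) (v≡V-⅔n m) ⟨
    ½ ℚ.* v m ∎
    where
    x : ℚ
    x = + m ℚ./ 1
    regroup : ∀ x y → x ℚ.+ ½ ℚ.* y ℚ.- ⅔ ℚ.* ((+ 2 ℚ./ 1) ℚ.* x) ≡ ½ ℚ.* (y ℚ.- ⅔ ℚ.* x)
    regroup = solve 2 (λ x y → x :+ con ½ :* y :- con ⅔ :* (con (+ 2 ℚ./ 1) :* x)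
                               := con ½ :* (y :- con ⅔ :* x)) refl

  v-double+1 : ∀ m → v (1 + 2 * m) ≡ ½ ℚ.* v m ℚ.+ ⅓
  v-double+1 m = begin
    v (1 + 2 * m)
      ≡⟨ v≡V-⅔n (1 + 2 * m) ⟩
    V (2 * m) ℚ.+ r₁ ℚ.- ⅔ ℚ.* (+ (1 + 2 * m) ℚ./ 1)
      ≡⟨ cong₂ (λ y z → y ℚ.- ⅔ ℚ.* z) V[1+2m] [1+2m]/1 ⟩
    x ℚ.+ ½ ℚ.* V m ℚ.+ 1ℚ ℚ.- ⅔ ℚ.* (1ℚ ℚ.+ (+ 2 ℚ./ 1) ℚ.* x)
      ≡⟨ regroup x (V m) ⟩
    ½ ℚ.* (V m ℚ.- ⅔ ℚ.* x) ℚ.+ ⅓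
      ≡⟨ cong (λ y → ½ ℚ.* y ℚ.+ ⅓) (v≡V-⅔n m) ⟨
    ½ ℚ.* v m ℚ.+ ⅓ ∎
    where
    x r₁ : ℚ
    x  = + m ℚ./ 1
    r₁ = + α (1 + 2 * m) ℚ./ (1 + 2 * m)
    V[1+2m] : V (2 * m) ℚ.+ r₁ ≡ x ℚ.+ ½ ℚ.* V m ℚ.+ 1ℚ
    V[1+2m] = cong₂ ℚ._+_ (V-double m) (α-ratio-odd m)
    [1+2m]/1 : + (1 + 2 * m) ℚ./ 1 ≡ 1ℚ ℚ.+ (+ 2 ℚ./ 1) ℚ.* x
    [1+2m]/1 = trans (/-distribʳ-+ 1 (2 * m) 0) (cong (1ℚ ℚ.+_) (/-distrib-* 2 m 0 0))
    regroup : ∀ x y → x ℚ.+ ½ ℚ.* y ℚ.+ 1ℚ ℚ.- ⅔ ℚ.* (1ℚ ℚ.+ (+ 2 ℚ./ 1) ℚ.* x)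
                      ≡ ½ ℚ.* (y ℚ.- ⅔ ℚ.* x) ℚ.+ ⅓
    regroup = solve 2 (λ x y → x :+ con ½ :* y :+ con 1ℚ :- con ⅔ :* (con 1ℚ :+ con (+ 2 ℚ./ 1) :* x)
                               := con ½ :* (y :- con ⅔ :* x) :+ con ⅓) refl

Between : ℚ → ℚ → ℚ → Set
Between a b x = a ℚ.< x × x ℚ.< b

*-between : ∀ c .{{_ : Positive c}} {a b x} → Between a b x → Between (c ℚ.* a) (c ℚ.* b) (c ℚ.* x)
*-between c (a<x , x<b) = *-monoʳ-<-pos c a<x , *-monoʳ-<-pos c x<b

+-between : ∀ c {a b x} → Between a b x → Between (a ℚ.+ c) (b ℚ.+ c) (x ℚ.+ c)
+-between c (a<x , x<b) = +-monoˡ-< c a<x , +-monoˡ-< c x<b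

between-weaken : ∀ {a b c d x} → c ℚ.≤ a → b ℚ.≤ d → Between a b x → Between c d x
between-weaken c≤a b≤d (a<x , x<b) = ≤-<-trans c≤a a<x , <-≤-trans x<b b≤d

0<⅓ : 0ℚ ℚ.< ⅓
0<⅓ = *<* (+<+ z<s)

⅓<⅔ : ⅓ ℚ.< ⅔
⅓<⅔ = *<* (+<+ (s<s (s<s (s<s z<s))))

v-double-between : ∀ m → Between 0ℚ ⅔ (v m) → Between 0ℚ ⅓ (v (2 * m))
v-double-between m b = subst (Between 0ℚ ⅓) (sym (v-double m)) (*-between ½ b)

v-double+1-between : ∀ m → Between 0ℚ ⅔ (v m) → Between ⅓ ⅔ (v (1 + 2 * m))
v-double+1-between m b = subst (Between ⅓ ⅔) (sym (v-double+1 m)) (+-between ⅓ (*-between ½ b))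

data Halving : ℕ → Set where
  even : ∀ m → Halving (2 * m)
  odd  : ∀ m → Halving (1 + 2 * m)

halving : ∀ n → Halving n
halving zero = even 0
halving (suc n) with halving n
... | even m = odd m
... | odd m  = subst Halving (*-suc 2 m) (even (suc m))

v-between : ∀ n → 0 < n → Between 0ℚ ⅔ (v n)
v-between = <-rec _ (λ n rec → from-halving (halving n) rec)
  where
  from-halving : ∀ {n} → Halving n → (∀ {m} → m < n → 0 < m → Between 0ℚ ⅔ (v m)) →
                 0 < n → Between 0ℚ ⅔ (v n)
  from-halving (even zero)    _   ()
  from-halving (even (suc m)) rec _ =
    between-weaken ≤-refl (<⇒≤ ⅓<⅔) (v-double-between (suc m) (rec (m<m+n (suc m) z<s) z<s))
  from-halving (odd zero)     _   _ = 0<⅓ , ⅓<⅔    -- v 1 computes to ⅓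
  from-halving (odd (suc m))  rec _ =
    between-weaken (<⇒≤ 0<⅓) ≤-refl (v-double+1-between (suc m) (rec (m<n⇒m<1+n (m<m+n (suc m) z<s)) z<s))

corollary3 : (n : ℕ) → 0 < n →
    (((+ 1) ℚ./ 3) ℚ.< v (2 * n + 1) × v (2 * n + 1) ℚ.< ((+ 2) ℚ./ 3)) ×
    (0ℚ ℚ.< v (2 * n) × v (2 * n) ℚ.< ((+ 1) ℚ./ 3))
corollary3 n 0<n =
  subst (λ k → Between ⅓ ⅔ (v k)) (+-comm 1 (2 * n)) (v-double+1-between n v[n]-between) ,
  v-double-between n v[n]-between
  where
  v[n]-between : Between 0ℚ ⅔ (v n)
  v[n]-between = v-between n 0<n
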